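{- Let $D=(V,A)$ be a loopless digraph with minimum in-degree at least $1$, and let $\mathcal{L}D=\mathcal{L}_{(A',\phi)}D$ be a partial line digraph of $D$. Then (i) the number of kernels of $D$ equals the number of kernels of $\mathcal{L}D$; (ii) the number of quasikernels of $D$ is less than or equal to the number of quasikernels of $\mathcal{L}D$.
   Context: Directed distance $d(x,y)$ is the length of a shortest directed path from $x$ to $y$; $d(x,K)=\min_{y\in K}d(x,y)$. A $(k,l)$-kernel is a vertex set $K$ with $d(u,v)\ge k$ for all distinct $u,v\in K$ and $d(x,K)\le l$ for every vertex $x\notin K$. A kernel is a $(2,1)$-kernel (an independent set such that every vertex outside it has an out-neighbour in it); a quasikernel is a $(2,2)$-kernel. For a vertex $x$, $\omega^-(x)$ is the set of arcs with terminal vertex $x$; for a set of arcs $\Omega$, $H(\Omega)=\{y:(x,y)\in\Omega\}$. An arc $(i,j)$ is written $ij$. Partial line digraph: take $A'\subseteq A$ and a surjective map $\phi:A\to A'$ such that (i) $H(A')=V$; (ii) $\phi|_{A'}$ is the identity, and for every $j\in V$, $\phi(\omega^-(j))\subseteq\omega^-(j)\cap A'$. Then $\mathcal{L}_{(A',\phi)}D$ has vertex set $A'$ and arc set $\{(ij,\phi(jk)): ij\in A',\ (j,k)\in A\}$. -}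

module Defs where

open import Data.Bool using (Bool; true; false)
open import Data.Nat using (ℕ; zero; suc; _∸_)
open import Data.Fin using (Fin; _≟_)
open import Data.Fin.Properties using (any?; all?)
open import Data.Fin.Subset using (Subset; _∈_; _∉_)
open import Data.Fin.Subset.Properties using (_∈?_)
open import Data.Vec using ([]; _∷_)
open import Data.List using (List; []; _∷_; map; _++_; filter; length)
open import Data.Product using (Σ; ∃; ∃-syntax; _×_; _,_; proj₁; proj₂)
open import Data.Sum using (_⊎_)
open import Function.Bundles using (_⇔_)
open import Relation.Nullary using (¬_; Dec; yes; no)
open import Relation.Nullary.Decidable using (_×-dec_; _⊎-dec_; _→-dec_; ¬?)
open import Relation.Binary.PropositionalEquality using (_≡_; _≢_)

Digraph : ℕ → Set
Digraph n = Fin n → Fin n → Bool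

Arc : ∀ {n} → Digraph n → Fin n → Fin n → Set
Arc D i j = D i j ≡ true

Loopless : ∀ {n} → Digraph n → Set
Loopless D = ∀ i → D i i ≡ false

MinInDegree≥1 : ∀ {n} → Digraph n → Set
MinInDegree≥1 D = ∀ j → ∃[ i ] Arc D i j

-- Reach D m x y : there is a directed walk of length ≤ m from x to y,
-- i.e. d(x , y) ≤ m.
Reach : ∀ {n} → Digraph n → ℕ → Fin n → Fin n → Set
Reach D zero    x y = x ≡ y
Reach D (suc m) x y = Reach D m x y ⊎ (∃[ z ] (Arc D x z × Reach D m z y))

-- (k,l)-kernel: d(u,v) ≥ k for distinct u,v ∈ K (i.e. not d(u,v) ≤ k-1),
-- and d(x,K) ≤ l for x ∉ K.
IsKLKernel : ∀ {n} → Digraph n → ℕ → ℕ → Subset n → Set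
IsKLKernel D k l K =
  (∀ u v → u ∈ K → v ∈ K → u ≢ v → ¬ Reach D (k ∸ 1) u v)
  × (∀ x → x ∉ K → ∃[ y ] (y ∈ K × Reach D l x y))

IsKernel : ∀ {n} → Digraph n → Subset n → Set
IsKernel D = IsKLKernel D 2 1

IsQuasikernel : ∀ {n} → Digraph n → Subset n → Set
IsQuasikernel D = IsKLKernel D 2 2

reach? : ∀ {n} (D : Digraph n) m x y → Dec (Reach D m x y)
reach? D zero x y = x ≟ y
reach? D (suc m) x y =
  reach? D m x y ⊎-dec any? (λ z → (D x z Data.Bool.≟ true) ×-dec reach? D m z y)

isKLKernel? : ∀ {n} (D : Digraph n) k l K → Dec (IsKLKernel D k l K)
isKLKernel? D k l K =
  all? (λ u → all? (λ v → (u ∈? K) →-dec (v ∈? K) →-dec ¬? (u ≟ v)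
                            →-dec ¬? (reach? D (k ∸ 1) u v)))
  ×-dec all? (λ x → ¬? (x ∈? K) →-dec any? (λ y → (y ∈? K) ×-dec reach? D l x y))

subsets : ∀ n → List (Subset n)
subsets zero    = [] ∷ []
subsets (suc n) = map (false ∷_) (subsets n) ++ map (true ∷_) (subsets n)

numKLKernels : ∀ {n} → Digraph n → ℕ → ℕ → ℕ
numKLKernels {n} D k l = length (filter (isKLKernel? D k l) (subsets n))

numKernels : ∀ {n} → Digraph n → ℕ
numKernels D = numKLKernels D 2 1

numQuasikernels : ∀ {n} → Digraph n → ℕ
numQuasikernels D = numKLKernels D 2 2

-- Partial line digraph L_(A',φ) D of D, given up to isomorphism:
-- its vertex set Fin m is identified with A' by the bijection ι.
-- A' is given by its indicator matrix, φ : A → A' as a function on pairs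
-- (only its values on arcs of D matter).
record PartialLineDigraph {n} (D : Digraph n) : Set where
  field
    A'        : Fin n → Fin n → Bool
    A'⊆A      : ∀ i j → A' i j ≡ true → Arc D i j
    φ         : Fin n → Fin n → Fin n × Fin n
    φ-into-A' : ∀ i j → Arc D i j → A' (proj₁ (φ i j)) (proj₂ (φ i j)) ≡ true
    φ-surj    : ∀ i j → A' i j ≡ true → ∃[ i' ] ∃[ j' ] (Arc D i' j' × φ i' j' ≡ (i , j))
    H[A']≡V   : ∀ j → ∃[ i ] (A' i j ≡ true)
    -- (ii) φ is the identity on A' and φ(ω⁻(j)) ⊆ ω⁻(j) ∩ A'
    φ-id      : ∀ i j → A' i j ≡ true → φ i j ≡ (i , j)
    φ-head    : ∀ i j → Arc D i j → proj₂ (φ i j) ≡ j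
    m         : ℕ
    L         : Digraph m
    ι         : Fin m → Fin n × Fin n
    ι-inj     : ∀ a b → ι a ≡ ι b → a ≡ b
    ι-in-A'   : ∀ a → A' (proj₁ (ι a)) (proj₂ (ι a)) ≡ true
    ι-onto    : ∀ i j → A' i j ≡ true → ∃[ a ] (ι a ≡ (i , j))
    L-arcs    : ∀ a b → Arc L a b
                  ⇔ (∃[ k ] (Arc D (proj₂ (ι a)) k × ι b ≡ φ (proj₂ (ι a)) k))

-- The head map ij ↦ j from the vertices of ℒD to those of D is a surjective
-- digraph homomorphism that lifts arcs (jk ∈ A lifts to ij → φ(jk)), and
-- vertices with the same head have the same out-neighbours in ℒD.  Hence the
-- preimage of a (2,l)-kernel of D is a (2,l)-kernel of ℒD, injectively.  For
-- kernels the converse also holds: a kernel of ℒD is a union of fibres of the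
-- head map (a vertex sharing its head with a kernel vertex cannot be absorbed
-- by one arc without violating independence), so it is the preimage of its
-- image, and that image is a kernel of D.
module Submission where

open import Defs
open import Level using (Level)
open import Data.Bool using (true; false)
open import Data.Bool.Properties using (¬-not)
open import Data.Nat using (_≤_; _+_; suc; z≤n; s≤s)
open import Data.Nat.Properties using (≤-antisym; ≤-trans; ≤-reflexive; +-suc; module ≤-Reasoning)
open import Data.Fin using (Fin; _≟_)
open import Data.Fin.Properties using (any?)
open import Data.Fin.Subset using (Subset; _∈_; _∉_)
open import Data.Fin.Subset.Properties using (_∈?_; ⊆-antisym)
open import Data.Vec using ([]; _∷_; tabulate)
open import Data.Vec.Properties using (lookup∘tabulate; []=⇒lookup; lookup⇒[]=; ∷-injectiveʳ)
open import Data.List using (List; []; _∷_; map; _++_; filter; length)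
open import Data.List.Properties using (length-++; length-map)
open import Data.List.Relation.Unary.Any using (here; there)
import Data.List.Relation.Unary.All as All
import Data.List.Relation.Unary.All.Properties as All
open import Data.List.Relation.Unary.AllPairs using ([]; _∷_)
open import Data.List.Relation.Unary.Unique.Propositional using (Unique)
import Data.List.Relation.Unary.Unique.Propositional.Properties as Unique
open import Data.List.Membership.Propositional using () renaming (_∈_ to _∈ₗ_)
open import Data.List.Membership.Propositional.Properties
  using (∈-∃++; ∈-++⁺ˡ; ∈-++⁺ʳ; ∈-map⁺; ∈-map⁻; ∈-filter⁺; ∈-filter⁻)
open import Data.List.Relation.Binary.Subset.Propositional using (_⊆_)
open import Data.Product using (_×_; _,_; proj₂; ∃-syntax)
open import Data.Sum using (inj₁; inj₂)
open import Function.Bundles using (Equivalence)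
open import Relation.Nullary using (¬_; Dec; yes; no; does; contradiction)
open import Relation.Nullary.Decidable using (_×-dec_; dec-true)
open import Relation.Unary using (Pred; Decidable)
open import Relation.Binary.PropositionalEquality
  using (_≡_; _≢_; refl; sym; trans; cong; subst; module ≡-Reasoning)

private
  variable
    p q : Level
    A B : Set

∈-++-∷⁻ : ∀ {v w : A} us {vs} → w ∈ₗ us ++ v ∷ vs → w ≢ v → w ∈ₗ us ++ vs
∈-++-∷⁻ []       (here w≡v)  w≢v = contradiction w≡v w≢v
∈-++-∷⁻ []       (there w∈)  _   = w∈
∈-++-∷⁻ (u ∷ us) (here w≡u)  _   = here w≡u
∈-++-∷⁻ (u ∷ us) (there w∈)  w≢v = there (∈-++-∷⁻ us w∈ w≢v)

unique-⊆⇒length≤ : {xs ys : List A} → Unique xs → xs ⊆ ys → length xs ≤ length ys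
unique-⊆⇒length≤ {xs = []}     _            _    = z≤n
unique-⊆⇒length≤ {xs = x ∷ xs} (x∉xs ∷ uxs) x∷xs⊆ys
  with us , vs , refl ← ∈-∃++ (x∷xs⊆ys (here refl)) = begin
    suc (length xs)             ≤⟨ s≤s (unique-⊆⇒length≤ uxs xs⊆us++vs) ⟩
    suc (length (us ++ vs))     ≡⟨ cong suc (length-++ us) ⟩
    suc (length us + length vs) ≡⟨ +-suc (length us) (length vs) ⟨
    length us + length (x ∷ vs) ≡⟨ length-++ us ⟨
    length (us ++ x ∷ vs)       ∎
  where
  open ≤-Reasoning
  xs⊆us++vs : xs ⊆ us ++ vs
  xs⊆us++vs y∈xs = ∈-++-∷⁻ us (x∷xs⊆ys (there y∈xs)) λ { refl → All.lookup x∉xs y∈xs refl }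

map⁺-injectiveOn : {xs : List A} (f : A → B) →
                   (∀ {x y} → x ∈ₗ xs → y ∈ₗ xs → f x ≡ f y → x ≡ y) →
                   Unique xs → Unique (map f xs)
map⁺-injectiveOn f inj []            = []
map⁺-injectiveOn f inj (x∉xs ∷ uxs) =
  All.map⁺ (All.tabulate λ y∈xs fx≡fy → All.lookup x∉xs y∈xs (inj (here refl) (there y∈xs) fx≡fy))
  ∷ map⁺-injectiveOn f (λ x∈ y∈ → inj (there x∈) (there y∈)) uxs

length-filter-≤ : {P : Pred A p} {Q : Pred B q} (P? : Decidable P) (Q? : Decidable Q)
                  {xs : List A} {ys : List B} (f : A → B) →
                  (∀ {x} → P x → Q (f x)) →
                  (∀ {x y} → P x → P y → f x ≡ f y → x ≡ y) →
                  Unique xs → (∀ y → y ∈ₗ ys) →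
                  length (filter P? xs) ≤ length (filter Q? ys)
length-filter-≤ {P = P} P? Q? {xs} {ys} f P⇒Q inj uxs complete =
  ≤-trans (≤-reflexive (sym (length-map f (filter P? xs))))
          (unique-⊆⇒length≤ (map⁺-injectiveOn f injOn (Unique.filter⁺ P? uxs)) image⊆)
  where
  P-of : ∀ {x} → x ∈ₗ filter P? xs → P x
  P-of x∈ = proj₂ (∈-filter⁻ P? {xs = xs} x∈)
  injOn : ∀ {x y} → x ∈ₗ filter P? xs → y ∈ₗ filter P? xs → f x ≡ f y → x ≡ y
  injOn x∈ y∈ = inj (P-of x∈) (P-of y∈)
  image⊆ : map f (filter P? xs) ⊆ filter Q? ys
  image⊆ z∈ with x , x∈ , refl ← ∈-map⁻ f z∈ = ∈-filter⁺ Q? (complete (f x)) (P⇒Q (P-of x∈))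

∈-subsets : ∀ {n} (K : Subset n) → K ∈ₗ subsets n
∈-subsets []          = here refl
∈-subsets (false ∷ K) = ∈-++⁺ˡ (∈-map⁺ (false ∷_) (∈-subsets K))
∈-subsets (true ∷ K)  = ∈-++⁺ʳ _ (∈-map⁺ (true ∷_) (∈-subsets K))

subsets-unique : ∀ n → Unique (subsets n)
subsets-unique 0       = All.[] ∷ []
subsets-unique (suc n) = Unique.++⁺ (Unique.map⁺ ∷-injectiveʳ (subsets-unique n))
                                    (Unique.map⁺ ∷-injectiveʳ (subsets-unique n))
                                    disjoint
  where
  disjoint : ∀ {K} → ¬ (K ∈ₗ map (false ∷_) (subsets n) × K ∈ₗ map (true ∷_) (subsets n))
  disjoint (K∈₀ , K∈₁) with _ , _ , refl ← ∈-map⁻ (false ∷_) K∈₀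
                          | _ , _ , () ← ∈-map⁻ (true ∷_) K∈₁

length-filter-subsets-≤ : ∀ {n m} {P : Pred (Subset n) p} {Q : Pred (Subset m) q}
                          (P? : Decidable P) (Q? : Decidable Q) (f : Subset n → Subset m) →
                          (∀ {K} → P K → Q (f K)) →
                          (∀ {K K′} → P K → P K′ → f K ≡ f K′ → K ≡ K′) →
                          length (filter P? (subsets n)) ≤ length (filter Q? (subsets m))
length-filter-subsets-≤ {n = n} P? Q? f P⇒Q inj =
  length-filter-≤ P? Q? f P⇒Q inj (subsets-unique n) ∈-subsets

toSubset : ∀ {k} {P : Pred (Fin k) p} → Decidable P → Subset k
toSubset P? = tabulate (λ x → does (P? x))

module _ {k} {P : Pred (Fin k) p} (P? : Decidable P) {x : Fin k} where

  ∈-toSubset⁺ : P x → x ∈ toSubset P?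
  ∈-toSubset⁺ px = lookup⇒[]= x _ (trans (lookup∘tabulate _ x) (dec-true (P? x) px))

  ∈-toSubset⁻ : x ∈ toSubset P? → P x
  ∈-toSubset⁻ x∈ = does≡true⇒ (P? x) (trans (sym (lookup∘tabulate _ x)) ([]=⇒lookup x∈))
    where
    does≡true⇒ : ∀ {X : Set p} (X? : Dec X) → does X? ≡ true → X
    does≡true⇒ (yes px) _  = px
    does≡true⇒ (no _)   ()

Independent : ∀ {n} → Digraph n → Subset n → Set
Independent D K = ∀ {u v} → u ∈ K → v ∈ K → ¬ Arc D u v

module _ {n} {D : Digraph n} {K : Subset n} where

  independent⇒distance≥2 : Independent D K → ∀ u v → u ∈ K → v ∈ K → u ≢ v → ¬ Reach D 1 u v
  independent⇒distance≥2 ind u v u∈ v∈ u≢v (inj₁ u≡v)               = u≢v u≡v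
  independent⇒distance≥2 ind u v u∈ v∈ u≢v (inj₂ (v , arc , refl)) = ind u∈ v∈ arc

  kernel⇒independent : ∀ {l} → Loopless D → IsKLKernel D 2 l K → Independent D K
  kernel⇒independent loopless (far , _) {u} {v} u∈ v∈ arc with u ≟ v
  ... | yes refl = contradiction (trans (sym arc) (loopless u)) λ ()
  ... | no u≢v   = far u v u∈ v∈ u≢v (inj₂ (v , arc , refl))

module HeadMap {n} (D : Digraph n) (P : PartialLineDigraph D) where
  open PartialLineDigraph P

  head : Fin m → Fin n
  head a = proj₂ (ι a)

  head-surjective : ∀ x → ∃[ a ] head a ≡ x
  head-surjective x
    with i , ix∈A′ ← H[A']≡V x
    with a , ιa≡ix ← ι-onto i x ix∈A′ = a , cong proj₂ ιa≡ix

  head-arc : ∀ {a b} → Arc L a b → Arc D (head a) (head b)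
  head-arc {a} {b} arc with k , jk∈A , ιb≡φjk ← Equivalence.to (L-arcs a b) arc =
    subst (Arc D (head a)) (sym (trans (cong proj₂ ιb≡φjk) (φ-head (head a) k jk∈A))) jk∈A

  lift-arc : ∀ {a k} → Arc D (head a) k → ∃[ b ] (Arc L a b × head b ≡ k)
  lift-arc {a} {k} jk∈A
    with b , ιb≡φjk ← ι-onto _ _ (φ-into-A' (head a) k jk∈A) =
    b , Equivalence.from (L-arcs a b) (k , jk∈A , ιb≡φjk)
      , trans (cong proj₂ ιb≡φjk) (φ-head (head a) k jk∈A)

  arc-sameHead : ∀ {a a′ b} → head a ≡ head a′ → Arc L a b → Arc L a′ b
  arc-sameHead {a} {a′} {b} ha≡ha′ arc with k , jk∈A , ιb≡φjk ← Equivalence.to (L-arcs a b) arc =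
    Equivalence.from (L-arcs a′ b)
      (k , subst (λ j → Arc D j k) ha≡ha′ jk∈A , subst (λ j → ι b ≡ φ j k) ha≡ha′ ιb≡φjk)

  head-reach : ∀ r {a b} → Reach L r a b → Reach D r (head a) (head b)
  head-reach 0       a≡b                    = cong head a≡b
  head-reach (suc r) (inj₁ R)               = inj₁ (head-reach r R)
  head-reach (suc r) (inj₂ (c , arc , R))   = inj₂ (head c , head-arc arc , head-reach r R)

  lift-reach : ∀ r {a y} → Reach D r (head a) y → ∃[ b ] (head b ≡ y × Reach L r a b)
  lift-reach 0       {a} ha≡y = a , ha≡y , refl
  lift-reach (suc r) (inj₁ R) with b , hb≡y , R′ ← lift-reach r R = b , hb≡y , inj₁ R′
  lift-reach (suc r) (inj₂ (z , arc , R))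
    with c , arc′ , refl ← lift-arc arc
    with b , hb≡y , R′ ← lift-reach r R =
    b , hb≡y , inj₂ (c , arc′ , R′)

  L-loopless : Loopless D → Loopless L
  L-loopless loopless a = ¬-not λ arc → contradiction (trans (sym (head-arc arc)) (loopless (head a))) λ ()

  preimage : Subset n → Subset m
  preimage K = toSubset (λ a → head a ∈? K)

  image : Subset m → Subset n
  image K′ = toSubset (λ x → any? λ a → (a ∈? K′) ×-dec (head a ≟ x))

  module _ {K : Subset n} {a : Fin m} where

    ∈-preimage⁺ : head a ∈ K → a ∈ preimage K
    ∈-preimage⁺ = ∈-toSubset⁺ (λ a → head a ∈? K)

    ∈-preimage⁻ : a ∈ preimage K → head a ∈ K
    ∈-preimage⁻ = ∈-toSubset⁻ (λ a → head a ∈? K)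

  module _ {K′ : Subset m} {x : Fin n} where

    ∈-image⁺ : ∃[ a ] (a ∈ K′ × head a ≡ x) → x ∈ image K′
    ∈-image⁺ = ∈-toSubset⁺ (λ x → any? λ a → (a ∈? K′) ×-dec (head a ≟ x))

    ∈-image⁻ : x ∈ image K′ → ∃[ a ] (a ∈ K′ × head a ≡ x)
    ∈-image⁻ = ∈-toSubset⁻ (λ x → any? λ a → (a ∈? K′) ×-dec (head a ≟ x))

  preimage-injective : ∀ {K₁ K₂} → preimage K₁ ≡ preimage K₂ → K₁ ≡ K₂
  preimage-injective eq = ⊆-antisym (preimage-reflects-⊆ eq) (preimage-reflects-⊆ (sym eq))
    where
    preimage-reflects-⊆ : ∀ {K₁ K₂} → preimage K₁ ≡ preimage K₂ → ∀ {x} → x ∈ K₁ → x ∈ K₂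
    preimage-reflects-⊆ eq {x} x∈ with a , refl ← head-surjective x =
      ∈-preimage⁻ (subst (a ∈_) eq (∈-preimage⁺ x∈))

  preimage-kernel : ∀ {l K} → Loopless D → IsKLKernel D 2 l K → IsKLKernel L 2 l (preimage K)
  preimage-kernel {l} {K} loopless ker@(_ , absorbs) =
    independent⇒distance≥2 independent , absorbs′
    where
    independent : Independent L (preimage K)
    independent a∈ b∈ arc =
      kernel⇒independent loopless ker (∈-preimage⁻ a∈) (∈-preimage⁻ b∈) (head-arc arc)
    absorbs′ : ∀ a → a ∉ preimage K → ∃[ b ] (b ∈ preimage K × Reach L l a b)
    absorbs′ a a∉
      with y , y∈ , R ← absorbs (head a) (λ ha∈ → a∉ (∈-preimage⁺ ha∈))
      with b , refl , R′ ← lift-reach l R = b , ∈-preimage⁺ y∈ , R′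

  module _ (loopless : Loopless D) {K′ : Subset m} (ker : IsKernel L K′) where

    private
      independent : Independent L K′
      independent = kernel⇒independent (L-loopless loopless) ker

    -- If a were absorbed by c ∈ K′, then so would be b, contradicting independence.
    kernel-closed : ∀ {a b} → head a ≡ head b → b ∈ K′ → a ∈ K′
    kernel-closed {a} ha≡hb b∈ with a ∈? K′
    ... | yes a∈ = a∈
    ... | no a∉ with proj₂ ker a a∉
    ...   | c , c∈ , inj₁ refl              = c∈
    ...   | c , c∈ , inj₂ (c , arc , refl) = contradiction (arc-sameHead ha≡hb arc) (independent b∈ c∈)

    image-kernel : IsKernel D (image K′)
    image-kernel = independent⇒distance≥2 independentᴰ , absorbs
      where
      independentᴰ : Independent D (image K′)
      independentᴰ u∈ v∈ arc
        with a , a∈ , refl ← ∈-image⁻ u∈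
        with b , b∈ , refl ← ∈-image⁻ v∈
        with c , arcᴸ , hc≡hb ← lift-arc arc =
        independent a∈ (kernel-closed hc≡hb b∈) arcᴸ
      absorbs : ∀ x → x ∉ image K′ → ∃[ y ] (y ∈ image K′ × Reach D 1 x y)
      absorbs x x∉
        with a , refl ← head-surjective x
        with c , c∈ , R ← proj₂ ker a (λ a∈ → x∉ (∈-image⁺ (a , a∈ , refl))) =
        head c , ∈-image⁺ (c , c∈ , refl) , head-reach 1 R

    preimage-image : preimage (image K′) ≡ K′
    preimage-image = ⊆-antisym ⊆K′ (λ a∈ → ∈-preimage⁺ (∈-image⁺ (_ , a∈ , refl)))
      where
      ⊆K′ : ∀ {a} → a ∈ preimage (image K′) → a ∈ K′
      ⊆K′ a∈ with b , b∈ , hb≡ha ← ∈-image⁻ (∈-preimage⁻ a∈) = kernel-closed (sym hb≡ha) b∈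

  image-injectiveOnKernels : Loopless D → ∀ {K₁ K₂} → IsKernel L K₁ → IsKernel L K₂ →
                             image K₁ ≡ image K₂ → K₁ ≡ K₂
  image-injectiveOnKernels loopless {K₁} {K₂} ker₁ ker₂ eq = begin
    K₁                     ≡⟨ preimage-image loopless ker₁ ⟨
    preimage (image K₁)    ≡⟨ cong preimage eq ⟩
    preimage (image K₂)    ≡⟨ preimage-image loopless ker₂ ⟩
    K₂                     ∎
    where open ≡-Reasoning

-- The hypothesis on the minimum in-degree is implied by H(A′) = V and A′ ⊆ A.
corollary2p5 : ∀ {n} (D : Digraph n) → Loopless D → MinInDegree≥1 D →
    (P : PartialLineDigraph D) →
    (numKernels D ≡ numKernels (PartialLineDigraph.L P))
    × (numQuasikernels D ≤ numQuasikernels (PartialLineDigraph.L P))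
corollary2p5 D loopless _ P =
  ≤-antisym (length-filter-subsets-≤ (isKLKernel? D 2 1) (isKLKernel? L 2 1) preimage
               (preimage-kernel loopless) (λ _ _ → preimage-injective))
            (length-filter-subsets-≤ (isKLKernel? L 2 1) (isKLKernel? D 2 1) image
               (image-kernel loopless) (image-injectiveOnKernels loopless))
  , length-filter-subsets-≤ (isKLKernel? D 2 2) (isKLKernel? L 2 2) preimage
      (preimage-kernel loopless) (λ _ _ → preimage-injective)
  where
  open PartialLineDigraph P using (L)
  open HeadMap D P
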